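{- Let $t$ be a positive integer, $\mu$ a $t$-core partition, $0\le i\le t-1$, and let $\lambda=(\mu;\lambda^0,\dots,\lambda^{t-1})$ and $\lambda^+=(\mu;\lambda^0,\dots,\lambda^{i-1},\lambda^i\cup\{\square_i\},\lambda^{i+1},\dots,\lambda^{t-1})$, where $\lambda^i\cup\{\square_i\}$ is a partition and $c_{\square_i}$ is the content of $\square_i$ in it. Then, as multisets, $$\mathcal C(\lambda^+)\setminus\mathcal C(\lambda)=\{c_{\square_i}t+b_i,\ c_{\square_i}t+b_i-1,\ \dots,\ c_{\square_i}t+b_i-(t-1)\},$$ where $b_i=b_i(\mu)$.
   Context: Partitions are identified with Young diagrams; the content of box $(i,j)$ (row $i$, column $j$) is $j-i$; $\mathcal C(\lambda)$ is the multiset of contents of boxes of $\lambda$. A $t$-core has no hook length divisible by $t$. The 01-sequence $(z_j)_{j\in\mathbb Z}$: traverse the boundary of the Young diagram from the bottom (infinite vertical ray below the first column) to the right (infinite horizontal ray right of the first row), labelling vertical edges $0$ and horizontal edges $1$, indexed so that $\#\{j\ge0:z_j=0\}=\#\{j<0:z_j=1\}$. Removing a $t$-hook exchanges some $z_j=1,z_{j+t}=0$ into $0,1$; the $t$-core is obtained by removing $t$-hooks until impossible. The $i$-th $t$-quotient $\lambda^i$ is the partition whose 01-sequence is $(z_{tj+i})_{j\in\mathbb Z}$ (up to re-indexing). The Littlewood decomposition $\lambda\mapsto(\lambda_{t\text{ -core}};\lambda^0,\dots,\lambda^{t-1})$ is a bijection from partitions to $\{t\text{ -cores}\}\times\{\text{partitions}\}^t$;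 we write $\lambda=(\lambda_{t\text{ -core}};\lambda^0,\dots,\lambda^{t-1})$. For a $t$-core $\mu$ with 01-sequence $(z_{\mu,j})$, $b_i(\mu)=\min\{j: j\equiv i\pmod t,\ z_{\mu,j}=1\}$. -}

module Defs where

open import Data.Bool using (Bool; true; false; not; if_then_else_)
open import Data.Nat using (ℕ; zero; suc; _≤_; _<_; _≥_; _∸_)
open import Data.Nat.Divisibility using (_∣_)
import Data.Nat as N
open import Data.Integer as ℤ using (ℤ; +_; -_; _-_)
open import Data.Integer using () renaming (_+_ to _+ℤ_; _*_ to _*ℤ_; _<_ to _<ℤ_; _<?_ to _<ℤ?_)
open import Data.List using (List; []; _∷_; length; map; upTo; filter; _++_; foldl)
open import Data.Bool.ListAction using (any)
open import Data.List.Relation.Unary.Linked using (Linked)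
open import Data.List.Relation.Unary.All using (All)
open import Data.Product using (Σ; ∃; _×_; _,_)
open import Relation.Binary.PropositionalEquality using (_≡_; _≢_)
open import Relation.Binary.Construct.Closure.ReflexiveTransitive using (Star)
open import Relation.Nullary using (¬_; yes; no)
open import Relation.Nullary.Decidable using (⌊_⌋)
open import Data.Vec using (Vec; lookup)
open import Data.Fin using (Fin)
import Data.Fin

IsPartition : List ℕ → Set
IsPartition λ₀ = Linked _≥_ λ₀ × All (0 <_) λ₀

-- k-th part (1-indexed); 0 beyond the length (and for k = 0).
part : List ℕ → ℕ → ℕ
part []       _             = 0
part (p ∷ ps) zero          = 0
part (p ∷ ps) (suc zero)    = p
part (p ∷ ps) (suc (suc k)) = part ps (suc k)

conj : List ℕ → ℕ → ℕ
conj λ₀ s = length (filter (λ p → s N.≤? p) λ₀)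

InDiagram : List ℕ → ℕ → ℕ → Set
InDiagram λ₀ r s = 1 ≤ r × 1 ≤ s × s ≤ part λ₀ r

hook : List ℕ → ℕ → ℕ → ℕ
hook λ₀ r s = (part λ₀ r ∸ s) N.+ (conj λ₀ s ∸ r) N.+ 1

IsTCore : ℕ → List ℕ → Set
IsTCore t μ = ∀ r s → InDiagram μ r s → ¬ (t ∣ hook μ r s)

-- Contents: multiset of s - r over boxes (r,s).

contentsFrom : ℕ → List ℕ → List ℤ
contentsFrom k []       = []
contentsFrom k (p ∷ ps) = map (λ s → + suc s - + k) (upTo p) ++ contentsFrom (suc k) ps

contents : List ℕ → List ℤ
contents = contentsFrom 1

del : ℤ → List ℤ → List ℤ
del x []       = []
del x (y ∷ ys) with x ℤ.≟ y
... | yes _ = ys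
... | no  _ = y ∷ del x ys

_∖_ : List ℤ → List ℤ → List ℤ
xs ∖ ys = foldl (λ acc y → del y acc) xs ys

-- 01-sequence: z_j = 0 (false) iff j = λ_k - k for some k ≥ 1
-- (the vertical boundary edge of row k sits at position λ_k - k).

z : List ℕ → ℤ → Bool
z λ₀ j with j <ℤ? - (+ length λ₀)
... | yes _ = false
... | no  _ = not (any (λ k → ⌊ (+ part λ₀ (suc k) - + suc k) ℤ.≟ j ⌋) (upTo (length λ₀)))

-- removing a t-hook: exchange z_j = 1, z_{j+t} = 0 into 0, 1
RemoveHook : ℕ → List ℕ → List ℕ → Set
RemoveHook t λ₀ λ₁ = IsPartition λ₁ × ∃ λ j →
  z λ₀ j ≡ true × z λ₀ (j +ℤ + t) ≡ false ×
  z λ₁ j ≡ false × z λ₁ (j +ℤ + t) ≡ true ×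
  (∀ k → k ≢ j → k ≢ j +ℤ + t → z λ₁ k ≡ z λ₀ k)

NoHook : ℕ → List ℕ → Set
NoHook t μ = ∀ j → ¬ (z μ j ≡ true × z μ (j +ℤ + t) ≡ false)

CoreOf : ℕ → List ℕ → List ℕ → Set
CoreOf t λ₀ μ = Star (RemoveHook t) λ₀ μ × NoHook t μ

QuotientOf : ℕ → ℕ → List ℕ → List ℕ → Set
QuotientOf t i λ₀ ν = ∃ λ sh → ∀ j → z ν j ≡ z λ₀ (+ t *ℤ (j +ℤ sh) +ℤ + i)

Littlewood : (t : ℕ) → List ℕ → List ℕ → Vec (List ℕ) t → Set
Littlewood t λ₀ μ qs = CoreOf t λ₀ μ × (∀ (j : Fin t) → QuotientOf t (Data.Fin.toℕ j) λ₀ (lookup qs j))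

AddBox : List ℕ → ℕ → ℕ → List ℕ → Set
AddBox λ₀ r s ν = 1 ≤ r × part λ₀ r N.+ 1 ≡ s × part ν r ≡ s × (∀ k → k ≢ r → part ν k ≡ part λ₀ k)

IsB : ℕ → ℕ → List ℕ → ℤ → Set
IsB t i μ b = (∃ λ m → b ≡ + i +ℤ + t *ℤ m) × z μ b ≡ true ×
  (∀ j → (∃ λ m → j ≡ + i +ℤ + t *ℤ m) → z μ j ≡ true → b ℤ.≤ j)

module Submission where

-- Write a partition through its 01-sequence, whose zeros ("beads") sit at λ_k − k.  Adding the
-- box □_i to λ^i moves the bead of its row from c − 1 to c, where c = c_{□_i}.  The i-th quotient
-- is the residue class i mod t of the 01-sequence, shifted by the charge of that class; charges
-- survive the removal of t-hooks, so the shift is the charge m of the class in the core, and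
-- b_i = i + t m.  Hence λ⁺ arises from λ by moving one bead from P = t (c − 1 + m) + i to P + t.
-- Through the beta-numbers e = λ_k + N − k, the contents of λ together with a multiset that
-- does not depend on λ form the union of the intervals (−N, e − N], so the move adds exactly the
-- contents P + 1, …, P + t, i.e. c t + b_i − k for 0 ≤ k < t.

open import Defs
open import Data.Nat using (ℕ)
open import Data.Integer using (ℤ; +_; _-_; _*_; _+_)
open import Data.List using (List; map; upTo)
open import Data.List.Relation.Binary.Permutation.Propositional using (_↭_)
open import Data.Vec using (Vec; lookup; _[_]≔_)
open import Data.Fin using (Fin; toℕ)

open import Data.Bool using (Bool; true; false; not)
import Data.Bool.Properties as Boolₚ
open import Data.Fin using (fromℕ<)
import Data.Fin.Properties as Finₚ
open import Data.Integer as ℤ using (-_; _≤_; _<_; ∣_∣)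
open import Data.Integer.DivMod using (_/ℕ_; _%ℕ_)
import Data.Integer.DivMod as ℤDivMod
import Data.Integer.Properties as ℤₚ
open import Data.Integer.Tactic.RingSolver using (solve-∀)
open import Data.List using ([]; _∷_; _++_; [_]; length; concatMap; applyUpTo)
import Data.List.Properties as Listₚ
open import Data.List.Membership.Propositional using (_∈_)
open import Data.List.Membership.Propositional.Properties using (∈-∃++)
open import Data.List.Relation.Binary.Permutation.Propositional
  using (refl; prep; swap; trans; ↭-sym; ↭-reflexive; ↭⇒↭ₛ; module PermutationReasoning)
open import Data.List.Relation.Binary.Permutation.Propositional.Properties
  using (++⁺ˡ; ++-comm; shift; shifts; drop-mid; ∈-resp-↭)
import Data.List.Relation.Binary.Permutation.Setoid.Properties as Permutationₛ
open import Data.List.Relation.Binary.Subset.Propositional using (_⊆_)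
open import Data.List.Relation.Unary.All as All using (All; []; _∷_)
open import Data.List.Relation.Unary.AllPairs using ([]; _∷_)
open import Data.List.Relation.Unary.Any using (here; there)
open import Data.List.Relation.Unary.Any.Properties using (any⁺; any⁻; applyUpTo⁺; applyUpTo⁻)
open import Data.List.Relation.Unary.Linked as Linked using (Linked; []; _∷_)
open import Data.List.Relation.Unary.Unique.Propositional using (Unique)
open import Data.Nat as ℕ using (zero; suc; z≤n; s≤s; _∸_; _≥_)
import Data.Nat.Properties as ℕₚ
import Data.Nat.Tactic.RingSolver as ℕ-Solver
open import Data.Product using (∃; _×_; _,_; proj₁; proj₂)
open import Data.Sum using (_⊎_; inj₁; inj₂; fromInj₂)
import Data.Vec.Properties as Vecₚ
open import Function using (Equivalence; _⇔_; mk⇔)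
import Function.Properties.Equivalence as ⇔
open import Relation.Binary using (tri<; tri≈; tri>)
open import Relation.Binary.Construct.Closure.ReflexiveTransitive using (Star; ε; _◅_)
open import Relation.Binary.PropositionalEquality
  using (_≡_; _≢_; refl; sym; cong; cong₂; subst; subst₂; setoid; module ≡-Reasoning)
  renaming (trans to ≡-trans)
open import Relation.Nullary using (¬_; Dec; yes; no; contradiction)
open import Relation.Nullary.Decidable using (⌊_⌋; toWitness; fromWitness)

del-head : ∀ x ys → del x (x ∷ ys) ≡ ys
del-head x ys with x ℤ.≟ x
... | yes _   = refl
... | no  x≢x = contradiction refl x≢x

del-≢-head : ∀ {x y} ys → x ≢ y → del x (y ∷ ys) ≡ y ∷ del x ys
del-≢-head {x} {y} ys x≢y with x ℤ.≟ y
... | yes x≡y = contradiction x≡y x≢y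
... | no  _   = refl

del-↭ : ∀ x {xs ys} → xs ↭ ys → del x xs ↭ del x ys
del-↭ x refl         = refl
del-↭ x (trans p q)  = trans (del-↭ x p) (del-↭ x q)
del-↭ x (prep y p) with x ℤ.≟ y
... | yes _ = p
... | no  _ = prep y (del-↭ x p)
del-↭ x (swap y w p) = del-swap (x ℤ.≟ y) (x ℤ.≟ w) p
  where
  del-swap : ∀ {xs ys} → Dec (x ≡ y) → Dec (x ≡ w) → xs ↭ ys →
             del x (y ∷ w ∷ xs) ↭ del x (w ∷ y ∷ ys)
  del-swap {xs} {ys} (yes refl) (yes refl) p
    rewrite del-head x (x ∷ xs) | del-head x (x ∷ ys) = prep x p
  del-swap {xs} {ys} (yes refl) (no x≢w) p
    rewrite del-head x (w ∷ xs) | del-≢-head (x ∷ ys) x≢w | del-head x ys = prep w p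
  del-swap {xs} {ys} (no x≢y) (yes refl) p
    rewrite del-≢-head (x ∷ xs) x≢y | del-head x xs | del-head x (y ∷ ys) = prep y p
  del-swap {xs} {ys} (no x≢y) (no x≢w) p
    rewrite del-≢-head (w ∷ xs) x≢y | del-≢-head xs x≢w
          | del-≢-head (y ∷ ys) x≢w | del-≢-head ys x≢y = swap y w (del-↭ x p)

∖-respˡ-↭ : ∀ zs {xs ys} → xs ↭ ys → xs ∖ zs ↭ ys ∖ zs
∖-respˡ-↭ []       p = p
∖-respˡ-↭ (z ∷ zs) p = ∖-respˡ-↭ zs (del-↭ z p)

xs++ys∖xs≡ys : ∀ xs ys → (xs ++ ys) ∖ xs ≡ ys
xs++ys∖xs≡ys []       ys = refl
xs++ys∖xs≡ys (x ∷ xs) ys =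
  ≡-trans (cong (λ l → l ∖ xs) (del-head x (xs ++ ys))) (xs++ys∖xs≡ys xs ys)

++-cancelʳ-↭ : ∀ {A : Set} {xs ys : List A} zs → xs ++ zs ↭ ys ++ zs → xs ↭ ys
++-cancelʳ-↭ {xs = xs} {ys} [] p =
  subst₂ _↭_ (Listₚ.++-identityʳ xs) (Listₚ.++-identityʳ ys) p
++-cancelʳ-↭ {xs = xs} {ys} (z ∷ zs) p = ++-cancelʳ-↭ zs (drop-mid {x = z} xs ys p)

concatMap-↭ : ∀ {A B : Set} (f : A → List B) {xs ys} → xs ↭ ys → concatMap f xs ↭ concatMap f ys
concatMap-↭ f refl         = refl
concatMap-↭ f (trans p q)  = trans (concatMap-↭ f p) (concatMap-↭ f q)
concatMap-↭ f (prep x p)   = ++⁺ˡ (f x) (concatMap-↭ f p)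
concatMap-↭ f (swap x y p) = trans (shifts (f x) (f y)) (++⁺ˡ (f y) (++⁺ˡ (f x) (concatMap-↭ f p)))

Unique-resp-↭ : ∀ {A : Set} {xs ys : List A} → xs ↭ ys → Unique xs → Unique ys
Unique-resp-↭ p = Permutationₛ.Unique-resp-↭ (setoid _) (↭⇒↭ₛ p)

∈⇒↭-∷ : ∀ {A : Set} {x : A} {xs} → x ∈ xs → ∃ λ ys → xs ↭ x ∷ ys
∈⇒↭-∷ {x = x} x∈xs with as , bs , refl ← ∈-∃++ x∈xs = as ++ bs , shift x as bs

unique-⊆-antisym : ∀ {A : Set} {xs ys : List A} → Unique xs → Unique ys → xs ⊆ ys → ys ⊆ xs → xs ↭ ys
unique-⊆-antisym {xs = []} {[]}    _ _ _ _ = refl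
unique-⊆-antisym {xs = []} {_ ∷ _} _ _ _ ys⊆xs with () ← ys⊆xs (here refl)
unique-⊆-antisym {xs = x ∷ xs} (x∉xs ∷ uxs) uys xs⊆ys ys⊆xs
  with ys′ , ys↭x∷ys′ ← ∈⇒↭-∷ (xs⊆ys (here refl)) =
  ↭-sym (trans ys↭x∷ys′ (prep x (↭-sym (unique-⊆-antisym uxs uys′ xs⊆ys′ ys′⊆xs))))
  where
  ux∷ys′ : Unique (x ∷ ys′)
  ux∷ys′ = Unique-resp-↭ ys↭x∷ys′ uys
  uys′ : Unique ys′
  uys′ with _ ∷ u ← ux∷ys′ = u
  xs⊆ys′ : xs ⊆ ys′
  xs⊆ys′ y∈xs with ∈-resp-↭ ys↭x∷ys′ (xs⊆ys (there y∈xs))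
  ... | here refl = contradiction refl (All.lookup x∉xs y∈xs)
  ... | there y∈ys′ = y∈ys′
  ys′⊆xs : ys′ ⊆ xs
  ys′⊆xs {y} y∈ys′ with ys⊆xs (∈-resp-↭ (↭-sym ys↭x∷ys′) (there y∈ys′)) | ux∷ys′
  ... | here refl    | x∉ys′ ∷ _ = contradiction refl (All.lookup x∉ys′ y∈ys′)
  ... | there y∈xs   | _        = y∈xs

≤⇒≡+ : ∀ {i j} → i ≤ j → ∃ λ n → j ≡ i + + n
≤⇒≡+ {i} {j} i≤j = ∣ j - i ∣ , sym (begin
  i + + ∣ j - i ∣ ≡⟨ cong (λ w → i + w) (ℤₚ.0≤i⇒+∣i∣≡i (ℤₚ.i≤j⇒0≤j-i i≤j)) ⟩
  i + (j - i)     ≡⟨ i+[j-i]≡j i j ⟩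
  j               ∎)
  where
  open ≡-Reasoning
  i+[j-i]≡j : ∀ i j → i + (j - i) ≡ j
  i+[j-i]≡j = solve-∀

+-cancelˡ-≡ : ∀ a {x y} → a + x ≡ a + y → x ≡ y
+-cancelˡ-≡ a {x} {y} eq = begin
  x             ≡⟨ x≡[a+x]-a a x ⟩
  (a + x) - a   ≡⟨ cong (_- a) eq ⟩
  (a + y) - a   ≡⟨ x≡[a+x]-a a y ⟨
  y             ∎
  where
  open ≡-Reasoning
  x≡[a+x]-a : ∀ a x → x ≡ (a + x) - a
  x≡[a+x]-a = solve-∀

≤∧≢⇒+1≤ : ∀ {i j} → i ≤ j → i ≢ j → i + + 1 ≤ j
≤∧≢⇒+1≤ {i} i≤j i≢j =
  subst (_≤ _) (ℤₚ.+-comm (+ 1) i) (ℤₚ.i<j⇒suc[i]≤j (ℤₚ.≤∧≢⇒< i≤j i≢j))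

i+1+n≡i+[1+n] : ∀ i n → (i + + 1) + + n ≡ i + + suc n
i+1+n≡i+[1+n] i n = ≡-trans (ℤₚ.+-assoc i (+ 1) (+ n)) (cong (λ w → i + w) (sym (ℤₚ.pos-+ 1 n)))

i+[1+n]≰i : ∀ i n → ¬ (i + + suc n ≤ i)
i+[1+n]≰i i n =
  ℤₚ.<⇒≱ (ℤₚ.≤-<-trans (ℤₚ.≤-reflexive (sym (ℤₚ.+-identityʳ i))) (ℤₚ.+-monoʳ-< i (ℤ.+<+ (s≤s z≤n))))

i≤+∣i∣ : ∀ i → i ≤ + ∣ i ∣
i≤+∣i∣ (+ n)      = ℤₚ.≤-refl
i≤+∣i∣ ℤ.-[1+ n ] = ℤ.-≤+

-∣i∣≤i : ∀ i → - + ∣ i ∣ ≤ i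
-∣i∣≤i (+ n)      = ℤₚ.neg-≤-pos
-∣i∣≤i ℤ.-[1+ n ] = ℤₚ.≤-refl

-- Counting ones in windows, and the charge of a 01-sequence

bit : Bool → ℕ
bit true  = 1
bit false = 0

count : (ℤ → Bool) → ℤ → ℕ → ℕ
count g A zero    = 0
count g A (suc n) = bit (g A) ℕ.+ count g (A + + 1) n

-- A sequence that is 0 far to the left and 1 far to the right has charge e when every
-- large window [A, A + n) contains A + n − e ones.
record HasCharge (g : ℤ → Bool) (e : ℤ) : Set where
  constructor beyond
  field
    bound  : ℕ
    count≡ : ∀ A n → A ≤ - + bound → + bound ≤ A + + n → + count g A n + e ≡ A + + n

step : ℤ → ℤ → Bool
step e x = ⌊ e ℤ.≤? x ⌋

count-cong : ∀ f g A n → (∀ x → A ≤ x → f x ≡ g x) → count f A n ≡ count g A n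
count-cong f g A zero    f≗g = refl
count-cong f g A (suc n) f≗g = cong₂ ℕ._+_ (cong bit (f≗g A ℤₚ.≤-refl))
  (count-cong f g (A + + 1) n (λ x A+1≤x → f≗g x (ℤₚ.≤-trans (ℤₚ.i≤i+j A (+ 1)) A+1≤x)))

count-shift : ∀ f g d A n → (∀ x → f x ≡ g (x + d)) → count f A n ≡ count g (A + d) n
count-shift f g d A zero    f≗g = refl
count-shift f g d A (suc n) f≗g = cong₂ ℕ._+_ (cong bit (f≗g A))
  (≡-trans (count-shift f g d (A + + 1) n f≗g) (cong (λ B → count g B n) (comm A d)))
  where
  comm : ∀ a d → (a + + 1) + d ≡ (a + d) + + 1
  comm = solve-∀

count-step : ∀ e A n → A ≤ e → e ≤ A + + n → + count (step e) A n + e ≡ A + + n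
count-step e A zero A≤e e≤A+0 = begin
  + 0 + e  ≡⟨ ℤₚ.+-identityˡ e ⟩
  e        ≡⟨ ℤₚ.≤-antisym e≤A+0 (ℤₚ.≤-trans (ℤₚ.≤-reflexive (ℤₚ.+-identityʳ A)) A≤e) ⟩
  A + + 0  ∎
  where open ≡-Reasoning
count-step e A (suc n) A≤e e≤A+1+n with e ℤ.≤? A
... | yes e≤A = begin
  + suc (count (step e) (A + + 1) n) + e ≡⟨ cong (λ k → + suc k + e) (count-ones (A + + 1) n e≤A+1) ⟩
  + suc n + e                            ≡⟨ cong (λ w → + suc n + w) (ℤₚ.≤-antisym e≤A A≤e) ⟩
  + suc n + A                            ≡⟨ ℤₚ.+-comm (+ suc n) A ⟩
  A + + suc n                            ∎
  where
  open ≡-Reasoning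
  e≤A+1 : e ≤ A + + 1
  e≤A+1 = ℤₚ.≤-trans e≤A (ℤₚ.i≤i+j A (+ 1))
  count-ones : ∀ B k → e ≤ B → count (step e) B k ≡ k
  count-ones B zero    _   = refl
  count-ones B (suc k) e≤B with e ℤ.≤? B
  ... | yes _   = cong suc (count-ones (B + + 1) k (ℤₚ.≤-trans e≤B (ℤₚ.i≤i+j B (+ 1))))
  ... | no  e≰B = contradiction e≤B e≰B
... | no e≰A = ≡-trans
  (count-step e (A + + 1) n (≤∧≢⇒+1≤ A≤e (λ A≡e → e≰A (ℤₚ.≤-reflexive (sym A≡e))))
                            (ℤₚ.≤-trans e≤A+1+n (ℤₚ.≤-reflexive (sym (i+1+n≡i+[1+n] A n)))))
  (i+1+n≡i+[1+n] A n)

A≤q⇒q+[1+n]≰A+0 : ∀ {A q} n → A ≤ q → ¬ (q + + suc n ≤ A + + 0)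
A≤q⇒q+[1+n]≰A+0 {A} {q} n A≤q q+1+n≤A =
  i+[1+n]≰i q n (ℤₚ.≤-trans q+1+n≤A (ℤₚ.≤-trans (ℤₚ.≤-reflexive (ℤₚ.+-identityʳ A)) A≤q))

count-point : ∀ f g q A n → (∀ x → x ≢ q → f x ≡ g x) → A ≤ q → q + + 1 ≤ A + + n →
  count f A n ℕ.+ bit (g q) ≡ count g A n ℕ.+ bit (f q)
count-point f g q A zero    _   A≤q q<A+n = contradiction q<A+n (A≤q⇒q+[1+n]≰A+0 0 A≤q)
count-point f g q A (suc n) f≗g A≤q q<A+n with A ℤ.≟ q
... | yes refl = begin
  (bit (f A) ℕ.+ count f (A + + 1) n) ℕ.+ bit (g A) ≡⟨ cong (λ k → (bit (f A) ℕ.+ k) ℕ.+ bit (g A)) tails ⟩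
  (bit (f A) ℕ.+ count g (A + + 1) n) ℕ.+ bit (g A) ≡⟨ exchange (bit (f A)) (bit (g A)) _ ⟩
  (bit (g A) ℕ.+ count g (A + + 1) n) ℕ.+ bit (f A) ∎
  where
  open ≡-Reasoning
  tails : count f (A + + 1) n ≡ count g (A + + 1) n
  tails = count-cong f g (A + + 1) n (λ x A+1≤x → f≗g x (λ { refl → i+[1+n]≰i A 0 A+1≤x }))
  exchange : ∀ a b c → (a ℕ.+ c) ℕ.+ b ≡ (b ℕ.+ c) ℕ.+ a
  exchange = ℕ-Solver.solve-∀
... | no A≢q = begin
  (bit (f A) ℕ.+ count f (A + + 1) n) ℕ.+ bit (g q) ≡⟨ ℕₚ.+-assoc (bit (f A)) _ _ ⟩
  bit (f A) ℕ.+ (count f (A + + 1) n ℕ.+ bit (g q)) ≡⟨ cong₂ ℕ._+_ (cong bit (f≗g A A≢q)) tails ⟩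
  bit (g A) ℕ.+ (count g (A + + 1) n ℕ.+ bit (f q)) ≡⟨ ℕₚ.+-assoc (bit (g A)) _ _ ⟨
  (bit (g A) ℕ.+ count g (A + + 1) n) ℕ.+ bit (f q) ∎
  where
  open ≡-Reasoning
  tails : count f (A + + 1) n ℕ.+ bit (g q) ≡ count g (A + + 1) n ℕ.+ bit (f q)
  tails = count-point f g q (A + + 1) n f≗g (≤∧≢⇒+1≤ A≤q A≢q)
            (ℤₚ.≤-trans q<A+n (ℤₚ.≤-reflexive (sym (i+1+n≡i+[1+n] A n))))

count-swap : ∀ f g q A n → (∀ x → x ≢ q → x ≢ q + + 1 → f x ≡ g x) →
  bit (f q) ℕ.+ bit (f (q + + 1)) ≡ bit (g q) ℕ.+ bit (g (q + + 1)) →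
  A ≤ q → q + + 2 ≤ A + + n → count f A n ≡ count g A n
count-swap f g q A zero _ _ A≤q q+2≤A+n = contradiction q+2≤A+n (A≤q⇒q+[1+n]≰A+0 1 A≤q)
count-swap f g q A (suc n) f≗g bits A≤q q+2≤A+n with A ℤ.≟ q
count-swap f g q A (suc zero) _ _ _ q+2≤A+1 | yes refl =
  contradiction (ℤₚ.≤-trans (ℤₚ.≤-reflexive (i+1+n≡i+[1+n] A 1)) q+2≤A+1) (i+[1+n]≰i (A + + 1) 0)
count-swap f g q A (suc (suc n)) f≗g bits A≤q q+2≤A+n | yes refl = begin
  bit (f A) ℕ.+ (bit (f (A + + 1)) ℕ.+ count f A+2 n) ≡⟨ ℕₚ.+-assoc (bit (f A)) _ _ ⟨
  (bit (f A) ℕ.+ bit (f (A + + 1))) ℕ.+ count f A+2 n ≡⟨ cong₂ ℕ._+_ bits tails ⟩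
  (bit (g A) ℕ.+ bit (g (A + + 1))) ℕ.+ count g A+2 n ≡⟨ ℕₚ.+-assoc (bit (g A)) _ _ ⟩
  bit (g A) ℕ.+ (bit (g (A + + 1)) ℕ.+ count g A+2 n) ∎
  where
  open ≡-Reasoning
  A+2 : ℤ
  A+2 = (A + + 1) + + 1
  tails : count f A+2 n ≡ count g A+2 n
  tails = count-cong f g A+2 n λ x A+2≤x → f≗g x
    (λ { refl → i+[1+n]≰i A 1 (ℤₚ.≤-trans (ℤₚ.≤-reflexive (sym (i+1+n≡i+[1+n] A 1))) A+2≤x) })
    (λ { refl → i+[1+n]≰i (A + + 1) 0 A+2≤x })
... | no A≢q = cong₂ ℕ._+_ (cong bit (f≗g A A≢q A≢q+1))
  (count-swap f g q (A + + 1) n f≗g bits (≤∧≢⇒+1≤ A≤q A≢q)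
    (ℤₚ.≤-trans q+2≤A+n (ℤₚ.≤-reflexive (sym (i+1+n≡i+[1+n] A n)))))
  where
  A≢q+1 : A ≢ q + + 1
  A≢q+1 refl = i+[1+n]≰i q 0 A≤q

charge-unique : ∀ {g e e′} → HasCharge g e → HasCharge g e′ → e ≡ e′
charge-unique {g} (beyond M count≡) (beyond M′ count≡′) =
  +-cancelˡ-≡ (+ count g A n) (≡-trans (count≡ A n A≤-M M≤A+n) (sym (count≡′ A n A≤-M′ M′≤A+n)))
  where
  K n : ℕ
  K = M ℕ.+ M′
  n = K ℕ.+ K
  A : ℤ
  A = - + K
  A+n≡K : A + + n ≡ + K
  A+n≡K = ≡-trans (cong (λ w → A + w) (ℤₚ.pos-+ K K)) (-k+[k+k]≡k (+ K))
    where
    -k+[k+k]≡k : ∀ k → - k + (k + k) ≡ k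
    -k+[k+k]≡k = solve-∀
  A≤-M : A ≤ - + M
  A≤-M = ℤₚ.neg-mono-≤ (ℤ.+≤+ (ℕₚ.m≤m+n M M′))
  A≤-M′ : A ≤ - + M′
  A≤-M′ = ℤₚ.neg-mono-≤ (ℤ.+≤+ (ℕₚ.m≤n+m M′ M))
  M≤A+n : + M ≤ A + + n
  M≤A+n = ℤₚ.≤-trans (ℤ.+≤+ (ℕₚ.m≤m+n M M′)) (ℤₚ.≤-reflexive (sym A+n≡K))
  M′≤A+n : + M′ ≤ A + + n
  M′≤A+n = ℤₚ.≤-trans (ℤ.+≤+ (ℕₚ.m≤n+m M′ M)) (ℤₚ.≤-reflexive (sym A+n≡K))

step-charge : ∀ e → HasCharge (step e) e
step-charge e = beyond ∣ e ∣ λ A n A≤-∣e∣ ∣e∣≤A+n →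
  count-step e A n (ℤₚ.≤-trans A≤-∣e∣ (-∣i∣≤i e)) (ℤₚ.≤-trans (i≤+∣i∣ e) ∣e∣≤A+n)

charge-cong : ∀ {f g e} → (∀ x → f x ≡ g x) → HasCharge f e → HasCharge g e
charge-cong {f} {g} {e} f≗g (beyond M count≡) = beyond M λ A n A≤-M M≤A+n →
  ≡-trans (cong (λ k → + k + e) (count-cong g f A n (λ x _ → sym (f≗g x)))) (count≡ A n A≤-M M≤A+n)

charge-shift : ∀ {f g e} d → (∀ x → f x ≡ g (x + d)) → HasCharge g e → HasCharge f (e - d)
charge-shift {f} {g} {e} d f≗g (beyond M count≡) =
  beyond (M ℕ.+ ∣ d ∣) λ A n A≤-M-∣d∣ M+∣d∣≤A+n → begin-equality
    + count f A n + (e - d)       ≡⟨ cong (λ k → + k + (e - d)) (count-shift f g d A n f≗g) ⟩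
    + count g (A + d) n + (e - d) ≡⟨ reassoc (+ count g (A + d) n) e d ⟩
    (+ count g (A + d) n + e) - d ≡⟨ cong (_- d) (count≡ (A + d) n (A+d≤-M A≤-M-∣d∣)
                                                           (M≤A+d+n {A} {n} M+∣d∣≤A+n)) ⟩
    ((A + d) + + n) - d           ≡⟨ cancel A d (+ n) ⟩
    A + + n                       ∎
  where
  open ℤₚ.≤-Reasoning
  reassoc : ∀ x e d → x + (e - d) ≡ (x + e) - d
  reassoc = solve-∀
  cancel : ∀ a d n → ((a + d) + n) - d ≡ a + n
  cancel = solve-∀
  A+d≤-M : ∀ {A} → A ≤ - + (M ℕ.+ ∣ d ∣) → A + d ≤ - + M
  A+d≤-M {A} A≤ = begin
    A + d                         ≤⟨ ℤₚ.+-mono-≤ A≤ (i≤+∣i∣ d) ⟩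
    - + (M ℕ.+ ∣ d ∣) + + ∣ d ∣   ≡⟨ cong (λ w → - w + + ∣ d ∣) (ℤₚ.pos-+ M ∣ d ∣) ⟩
    - (+ M + + ∣ d ∣) + + ∣ d ∣   ≡⟨ simplify (+ M) (+ ∣ d ∣) ⟩
    - + M                         ∎
    where
    simplify : ∀ a b → - (a + b) + b ≡ - a
    simplify = solve-∀
  M≤A+d+n : ∀ {A n} → + (M ℕ.+ ∣ d ∣) ≤ A + + n → + M ≤ (A + d) + + n
  M≤A+d+n {A} {n} ≤A+n = begin
    + M                           ≡⟨ simplify (+ M) (+ ∣ d ∣) ⟩
    (+ M + + ∣ d ∣) - + ∣ d ∣     ≡⟨ cong (_- + ∣ d ∣) (ℤₚ.pos-+ M ∣ d ∣) ⟨
    + (M ℕ.+ ∣ d ∣) - + ∣ d ∣     ≤⟨ ℤₚ.+-mono-≤ ≤A+n (-∣i∣≤i d) ⟩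
    (A + + n) + d                 ≡⟨ comm A (+ n) d ⟩
    (A + d) + + n                 ∎
    where
    simplify : ∀ a b → a ≡ (a + b) - b
    simplify = solve-∀
    comm : ∀ a n d → (a + n) + d ≡ (a + d) + n
    comm = solve-∀

charge-from-windows-containing : ∀ {g e} M q k →
  (∀ A n → A ≤ - + M → + M ≤ A + + n → A ≤ q → q + + k ≤ A + + n → + count g A n + e ≡ A + + n) →
  HasCharge g e
charge-from-windows-containing M q k count≡ = beyond (M ℕ.+ (∣ q ∣ ℕ.+ k)) λ A n A≤-M′ M′≤A+n →
  count≡ A n
    (ℤₚ.≤-trans A≤-M′ (ℤₚ.neg-mono-≤ (ℤ.+≤+ (ℕₚ.m≤m+n M _))))
    (ℤₚ.≤-trans (ℤ.+≤+ (ℕₚ.m≤m+n M _)) M′≤A+n)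
    (ℤₚ.≤-trans A≤-M′ (ℤₚ.≤-trans (ℤₚ.neg-mono-≤ (ℤ.+≤+ ∣q∣≤M′)) (-∣i∣≤i q)))
    (ℤₚ.≤-trans (ℤₚ.+-monoˡ-≤ (+ k) (i≤+∣i∣ q))
      (ℤₚ.≤-trans (ℤₚ.≤-reflexive (sym (ℤₚ.pos-+ ∣ q ∣ k)))
                  (ℤₚ.≤-trans (ℤ.+≤+ (ℕₚ.m≤n+m _ M)) M′≤A+n)))
  where
  ∣q∣≤M′ : ∣ q ∣ ℕ.≤ M ℕ.+ (∣ q ∣ ℕ.+ k)
  ∣q∣≤M′ = ℕₚ.≤-trans (ℕₚ.m≤m+n ∣ q ∣ k) (ℕₚ.m≤n+m _ M)

charge-swap : ∀ {f g e} q → (∀ x → x ≢ q → x ≢ q + + 1 → f x ≡ g x) →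
  bit (f q) ℕ.+ bit (f (q + + 1)) ≡ bit (g q) ℕ.+ bit (g (q + + 1)) →
  HasCharge f e → HasCharge g e
charge-swap {f} {g} {e} q f≗g bits (beyond M count≡) =
  charge-from-windows-containing M q 2 λ A n A≤-M M≤A+n A≤q q+2≤A+n →
    ≡-trans (cong (λ k → + k + e) (sym (count-swap f g q A n f≗g bits A≤q q+2≤A+n)))
            (count≡ A n A≤-M M≤A+n)

charge-point : ∀ {f g e} q → (∀ x → x ≢ q → f x ≡ g x) → f q ≡ false → g q ≡ true →
  HasCharge g e → HasCharge f (e + + 1)
charge-point {f} {g} {e} q f≗g fq≡0 gq≡1 (beyond M count≡) =
  charge-from-windows-containing M q 1 λ A n A≤-M M≤A+n A≤q q+1≤A+n → begin
    + count f A n + (e + + 1)  ≡⟨ reassoc (+ count f A n) e ⟩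
    (+ count f A n + + 1) + e  ≡⟨ cong (_+ e) (≡-trans (sym (ℤₚ.pos-+ (count f A n) 1))
                                                      (cong +_ (one-more A n A≤q q+1≤A+n))) ⟩
    + count g A n + e          ≡⟨ count≡ A n A≤-M M≤A+n ⟩
    A + + n                    ∎
  where
  open ≡-Reasoning
  reassoc : ∀ a e → a + (e + + 1) ≡ (a + + 1) + e
  reassoc = solve-∀
  one-more : ∀ A n → A ≤ q → q + + 1 ≤ A + + n → count f A n ℕ.+ 1 ≡ count g A n
  one-more A n A≤q q+1≤A+n = begin
    count f A n ℕ.+ 1          ≡⟨ cong (λ b → count f A n ℕ.+ bit b) gq≡1 ⟨
    count f A n ℕ.+ bit (g q)  ≡⟨ count-point f g q A n f≗g A≤q q+1≤A+n ⟩
    count g A n ℕ.+ bit (f q)  ≡⟨ cong (λ b → count g A n ℕ.+ bit b) fq≡0 ⟩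
    count g A n ℕ.+ 0          ≡⟨ ℕₚ.+-identityʳ _ ⟩
    count g A n                ∎

-- The 01-sequence of a partition

-- Rows beyond the length count as rows with λ_k = 0, so the zeros of z λ are
-- exactly the positions λ_k − k, k ≥ 1.
Bead : List ℕ → ℤ → Set
Bead l j = ∃ λ k → + part l (suc k) - + suc k ≡ j

part-beyond-length : ∀ l k → length l ℕ.≤ k → part l (suc k) ≡ 0
part-beyond-length []       k       _           = refl
part-beyond-length (p ∷ ps) (suc k) (s≤s |ps|≤k) = part-beyond-length ps k |ps|≤k

-[1+k]<-n⇒n≤k : ∀ {k} n → ℤ.-[1+ k ] < - + n → n ℕ.≤ k
-[1+k]<-n⇒n≤k zero    _             = z≤n
-[1+k]<-n⇒n≤k (suc n) (ℤ.-<- n<1+k) = n<1+k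

n≤k⇒-[1+k]<-n : ∀ {k} n → n ℕ.≤ k → ℤ.-[1+ k ] < - + n
n≤k⇒-[1+k]<-n zero    _   = ℤ.-<+
n≤k⇒-[1+k]<-n (suc n) n≤k = ℤ.-<- n≤k

<-length⇒Bead : ∀ l j → j < - + length l → Bead l j
<-length⇒Bead l (+ n)      j<-len = contradiction ℤₚ.neg-≤-pos (ℤₚ.<⇒≱ j<-len)
<-length⇒Bead l ℤ.-[1+ k ] j<-len =
  k , cong (λ p → + p - + suc k) (part-beyond-length l k (-[1+k]<-n⇒n≤k _ j<-len))

is-bead : List ℕ → ℤ → ℕ → Bool
is-bead l j k = ⌊ (+ part l (suc k) - + suc k) ℤ.≟ j ⌋

z≡false⇒Bead : ∀ l j → z l j ≡ false → Bead l j
z≡false⇒Bead l j z≡0 with j ℤ.<? - (+ length l)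
... | yes j<-len = <-length⇒Bead l j j<-len
... | no _
  with k , _ , bead? ← applyUpTo⁻ (λ k → k) {length l}
                         (any⁻ (is-bead l j) _ (Equivalence.from Boolₚ.T-≡ (Boolₚ.not-injective z≡0)))
  = k , toWitness bead?

Bead⇒z≡false : ∀ l j → Bead l j → z l j ≡ false
Bead⇒z≡false l j (k , bead) with j ℤ.<? - (+ length l)
... | yes _ = refl
... | no j≮-len with length l ℕ.≤? k
... | yes len≤k = contradiction
  (subst (_< - + length l) (≡-trans (cong (λ p → + p - + suc k) (sym (part-beyond-length l k len≤k))) bead)
         (n≤k⇒-[1+k]<-n _ len≤k))
  j≮-len
... | no len≰k = cong not
  (Equivalence.to Boolₚ.T-≡
    (any⁺ (is-bead l j) (applyUpTo⁺ (λ k → k) (fromWitness bead) (ℕₚ.≰⇒> len≰k))))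

z≡true⇒¬Bead : ∀ l j → z l j ≡ true → ¬ Bead l j
z≡true⇒¬Bead l j z≡1 bead with () ← ≡-trans (sym z≡1) (Bead⇒z≡false l j bead)

¬Bead⇒z≡true : ∀ l j → ¬ Bead l j → z l j ≡ true
¬Bead⇒z≡true l j ¬bead with z l j in z≡b
... | true  = refl
... | false = contradiction (z≡false⇒Bead l j z≡b) ¬bead

z-cong : ∀ l l′ x y → (Bead l x → Bead l′ y) → (Bead l′ y → Bead l x) → z l x ≡ z l′ y
z-cong l l′ x y to from with z l x in zx | z l′ y in zy
... | true  | true  = refl
... | false | false = refl
... | true  | false = contradiction (from (z≡false⇒Bead l′ y zy)) (z≡true⇒¬Bead l x zx)
... | false | true  = contradiction (to (z≡false⇒Bead l x zx)) (z≡true⇒¬Bead l′ y zy)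

z≡true⇒-length≤ : ∀ l j → z l j ≡ true → - + length l ≤ j
z≡true⇒-length≤ l j z≡1 with - + length l ℤ.≤? j
... | yes -len≤j = -len≤j
... | no  -len≰j = contradiction (<-length⇒Bead l j (ℤₚ.≰⇒> -len≰j)) (z≡true⇒¬Bead l j z≡1)

Bead-∷⁻ : ∀ p ps x → Bead (p ∷ ps) x → x ≡ + p - + 1 ⊎ Bead ps (x + + 1)
Bead-∷⁻ p ps x (zero  , bead) = inj₁ (sym bead)
Bead-∷⁻ p ps x (suc k , bead) = inj₂ (k , ≡-trans (next-row (+ part ps (suc k)) k) (cong (_+ + 1) bead))
  where
  next-row : ∀ a k → a - + suc k ≡ (a - + suc (suc k)) + + 1
  next-row a k = ≡-trans (simplify a (+ k)) (cong (λ w → (a - w) + + 1) (sym (ℤₚ.pos-+ 1 (suc k))))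
    where
    simplify : ∀ a k → a - (+ 1 + k) ≡ (a - (+ 1 + (+ 1 + k))) + + 1
    simplify = solve-∀

Bead-∷⁺ : ∀ p ps x → Bead ps (x + + 1) → Bead (p ∷ ps) x
Bead-∷⁺ p ps x (k , bead) =
  suc k , ≡-trans (prev-row (+ part ps (suc k)) k) (≡-trans (cong (_- + 1) bead) (x+1-1≡x x))
  where
  x+1-1≡x : ∀ x → (x + + 1) - + 1 ≡ x
  x+1-1≡x = solve-∀
  prev-row : ∀ a k → a - + suc (suc k) ≡ (a - + suc k) - + 1
  prev-row a k = ≡-trans (cong (λ w → a - w) (ℤₚ.pos-+ 1 (suc k))) (simplify a (+ suc k))
    where
    simplify : ∀ a k → a - (+ 1 + k) ≡ (a - k) - + 1
    simplify = solve-∀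

second≤first : ∀ {p ps} → Linked _≥_ (p ∷ ps) → part ps 1 ℕ.≤ p
second≤first {ps = []}    _         = z≤n
second≤first {ps = _ ∷ _} (p≥q ∷ _) = p≥q

part-antitone : ∀ {l} → Linked _≥_ l → ∀ {a b} → a ℕ.≤ b → part l (suc b) ℕ.≤ part l (suc a)
part-antitone {[]}     _   _               = z≤n
part-antitone {p ∷ ps} dec {zero}  {zero}  _ = ℕₚ.≤-refl
part-antitone {p ∷ ps} dec {zero}  {suc b} _ =
  ℕₚ.≤-trans (part-antitone (Linked.tail dec) z≤n) (second≤first dec)
part-antitone {p ∷ ps} dec {suc a} {suc b} (s≤s a≤b) = part-antitone (Linked.tail dec) a≤b

first-part≤⇒¬Bead : ∀ {l} → Linked _≥_ l → ∀ x → + part l 1 ≤ x → ¬ Bead l x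
first-part≤⇒¬Bead {l} dec x λ₁≤x (k , bead) =
  ℤₚ.<⇒≱ bead<λ₁ (ℤₚ.≤-trans λ₁≤x (ℤₚ.≤-reflexive (sym bead)))
  where
  bead<λ₁ : + part l (suc k) - + suc k < + part l 1
  bead<λ₁ = ℤₚ.<-≤-trans (subst (_< + part l (suc k)) (sym (ℤₚ.m-n≡m⊖n (part l (suc k)) (suc k)))
                           (ℤₚ.m⊖1+n<m (part l (suc k)) (suc k)))
                         (ℤ.+≤+ (part-antitone dec {0} {k} z≤n))

z-[] : ∀ x → z [] x ≡ step (+ 0) x
z-[] (+ n)      = ¬Bead⇒z≡true [] (+ n) λ ()
z-[] ℤ.-[1+ n ] = Bead⇒z≡false [] ℤ.-[1+ n ] (n , refl)

-- By induction on the rows: z (p ∷ ps) is z ps shifted by one, except for the bead at p − 1.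
partition-charge : ∀ {l} → Linked _≥_ l → HasCharge (z l) (+ 0)
partition-charge {[]}     _   = charge-cong (λ x → sym (z-[] x)) (step-charge (+ 0))
partition-charge {p ∷ ps} dec =
  charge-point (+ p - + 1) agree (Bead⇒z≡false (p ∷ ps) _ (0 , refl)) no-bead-after
    (charge-shift (+ 1) (λ _ → refl) (partition-charge (Linked.tail dec)))
  where
  agree : ∀ x → x ≢ + p - + 1 → z (p ∷ ps) x ≡ z ps (x + + 1)
  agree x x≢p-1 = z-cong (p ∷ ps) ps x (x + + 1)
    (λ bead → fromInj₂ (λ x≡p-1 → contradiction x≡p-1 x≢p-1) (Bead-∷⁻ p ps x bead))
    (Bead-∷⁺ p ps x)
  no-bead-after : z ps ((+ p - + 1) + + 1) ≡ true
  no-bead-after = ¬Bead⇒z≡true ps _ (first-part≤⇒¬Bead (Linked.tail dec) _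
    (ℤₚ.≤-trans (ℤ.+≤+ (second≤first dec)) (ℤₚ.≤-reflexive (sym (p-1+1≡p (+ p))))))
    where
    p-1+1≡p : ∀ p → (p - + 1) + + 1 ≡ p
    p-1+1≡p = solve-∀

-- Contents through beta-numbers

interval : ℤ → ℕ → List ℤ
interval a n = applyUpTo (λ s → a + + suc s) n

applyUpTo-cong : ∀ {A : Set} {f g : ℕ → A} n → (∀ s → f s ≡ g s) → applyUpTo f n ≡ applyUpTo g n
applyUpTo-cong zero    f≗g = refl
applyUpTo-cong (suc n) f≗g = cong₂ _∷_ (f≗g 0) (applyUpTo-cong n (λ s → f≗g (suc s)))

interval-suc : ∀ a n → interval a (suc n) ≡ (a + + 1) ∷ interval (a + + 1) n
interval-suc a n = cong ((a + + 1) ∷_) (applyUpTo-cong n (λ s → sym (i+1+n≡i+[1+n] a (suc s))))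

interval-++ : ∀ a m n → interval a (m ℕ.+ n) ≡ interval a m ++ interval (a + + m) n
interval-++ a zero    n = cong (λ b → interval b n) (sym (ℤₚ.+-identityʳ a))
interval-++ a (suc m) n = begin
  interval a (suc m ℕ.+ n)                 ≡⟨ interval-suc a (m ℕ.+ n) ⟩
  (a + + 1) ∷ interval (a + + 1) (m ℕ.+ n) ≡⟨ cong ((a + + 1) ∷_) (interval-++ (a + + 1) m n) ⟩
  (a + + 1) ∷ interval (a + + 1) m ++ interval ((a + + 1) + + m) n
    ≡⟨ cong₂ (λ u v → u ++ interval v n) (sym (interval-suc a m)) (i+1+n≡i+[1+n] a m) ⟩
  interval a (suc m) ++ interval (a + + suc m) n ∎
  where open ≡-Reasoning

interval-↭-descending : ∀ a n → interval a n ↭ map (λ k → (a + + n) - + k) (upTo n)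
interval-↭-descending a n = trans (descending n) (↭-reflexive (sym (Listₚ.map-upTo _ n)))
  where
  top-down : ∀ n k → (a + + n) - + k ≡ (a + + suc n) - + suc k
  top-down n k = ≡-trans (shift-both a (+ n) (+ k))
                         (cong₂ (λ u v → (a + u) - v) (sym (ℤₚ.pos-+ 1 n)) (sym (ℤₚ.pos-+ 1 k)))
    where
    shift-both : ∀ a n k → (a + n) - k ≡ (a + (+ 1 + n)) - (+ 1 + k)
    shift-both = solve-∀
  descending : ∀ n → interval a n ↭ applyUpTo (λ k → (a + + n) - + k) n
  descending zero    = refl
  descending (suc n) = begin
    interval a (suc n)                                  ≡⟨ Listₚ.applyUpTo-∷ʳ (λ s → a + + suc s) n ⟨
    interval a n ++ [ a + + suc n ]                     ↭⟨ ++-comm (interval a n) [ a + + suc n ] ⟩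
    (a + + suc n) ∷ interval a n                        ↭⟨ prep _ (descending n) ⟩
    (a + + suc n) ∷ applyUpTo (λ k → (a + + n) - + k) n
      ≡⟨ cong₂ _∷_ (sym (ℤₚ.+-identityʳ _)) (applyUpTo-cong n (top-down n)) ⟩
    applyUpTo (λ k → (a + + suc n) - + k) (suc n)       ∎
    where open PermutationReasoning

-- The beta-numbers λ_k + N − k, 1 ≤ k ≤ N: the beads of z λ above −N, shifted by N.
betaSet : ℕ → List ℕ → List ℕ
betaSet zero    _        = []
betaSet (suc m) []       = m ∷ betaSet m []
betaSet (suc m) (p ∷ ps) = p ℕ.+ m ∷ betaSet m ps

intervals : ℕ → List ℕ → List ℤ
intervals N = concatMap (interval (- + N))

row-contents≡interval : ∀ k p → map (λ s → + suc s - + suc k) (upTo p) ≡ interval (- + suc k) p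
row-contents≡interval k p =
  ≡-trans (Listₚ.map-upTo _ p) (applyUpTo-cong p (λ s → ℤₚ.+-comm (+ suc s) (- + suc k)))

interval-split : ∀ N m k p → suc k ℕ.+ m ≡ N →
  interval (- + N) (p ℕ.+ m) ≡ interval (- + N) m ++ interval (- + suc k) p
interval-split N m k p k+1+m≡N = begin
  interval (- + N) (p ℕ.+ m)                   ≡⟨ cong (interval (- + N)) (ℕₚ.+-comm p m) ⟩
  interval (- + N) (m ℕ.+ p)                   ≡⟨ interval-++ (- + N) m p ⟩
  interval (- + N) m ++ interval (- + N + + m) p ≡⟨ cong (λ a → interval (- + N) m ++ interval a p) -N+m≡-[1+k] ⟩
  interval (- + N) m ++ interval (- + suc k) p ∎
  where
  open ≡-Reasoning
  -N+m≡-[1+k] : - + N + + m ≡ - + suc k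
  -N+m≡-[1+k] = ≡-trans (cong (λ w → - + w + + m) (sym k+1+m≡N))
                (≡-trans (cong (λ w → - w + + m) (ℤₚ.pos-+ (suc k) m)) (simplify (+ suc k) (+ m)))
    where
    simplify : ∀ a b → - (a + b) + b ≡ - a
    simplify = solve-∀

-- Row k ≤ N has contents (−k, −k + λ_k], and interval (−N) (λ_k + N − k) splits as
-- interval (−N) (N − k) ++ (−k, −k + λ_k].
contentsFrom-++-↭ : ∀ N n k ps → k ℕ.+ n ≡ N → length ps ℕ.≤ n →
  contentsFrom (suc k) ps ++ intervals N (betaSet n []) ↭ intervals N (betaSet n ps)
contentsFrom-++-↭ N n       k []       _ _ = refl
contentsFrom-++-↭ N (suc m) k (p ∷ ps) k+1+m≡N (s≤s |ps|≤m) = begin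
  (row ++ C) ++ I ++ Y                     ≡⟨ Listₚ.++-assoc row C (I ++ Y) ⟩
  row ++ C ++ I ++ Y                       ↭⟨ ++⁺ˡ row (shifts C I) ⟩
  row ++ I ++ C ++ Y                       ↭⟨ shifts row I ⟩
  I ++ row ++ C ++ Y                       ↭⟨ ++⁺ˡ I (++⁺ˡ row IH) ⟩
  I ++ row ++ intervals N (betaSet m ps)   ≡⟨ Listₚ.++-assoc I row _ ⟨
  (I ++ row) ++ intervals N (betaSet m ps) ≡⟨ cong (_++ intervals N (betaSet m ps)) split ⟨
  interval (- + N) (p ℕ.+ m) ++ intervals N (betaSet m ps) ∎
  where
  open PermutationReasoning
  row C I Y : List ℤ
  row = map (λ s → + suc s - + suc k) (upTo p)
  C = contentsFrom (suc (suc k)) ps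
  I = interval (- + N) m
  Y = intervals N (betaSet m [])
  1+k+m≡N : suc k ℕ.+ m ≡ N
  1+k+m≡N = ≡-trans (sym (ℕₚ.+-suc k m)) k+1+m≡N
  IH : C ++ Y ↭ intervals N (betaSet m ps)
  IH = contentsFrom-++-↭ N m (suc k) ps 1+k+m≡N |ps|≤m
  split : interval (- + N) (p ℕ.+ m) ≡ I ++ row
  split = ≡-trans (interval-split N m k p 1+k+m≡N) (cong (I ++_) (sym (row-contents≡interval k p)))

contents-++-↭ : ∀ N l → length l ℕ.≤ N → contents l ++ intervals N (betaSet N []) ↭ intervals N (betaSet N l)
contents-++-↭ N l |l|≤N = contentsFrom-++-↭ N N 0 l refl |l|≤N

∈-betaSet⁻ : ∀ n ps {e} → e ∈ betaSet n ps → ∃ λ j → j ℕ.< n × e ≡ part ps (suc j) ℕ.+ (n ∸ suc j)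
∈-betaSet⁻ (suc m) []       (here refl) = 0 , s≤s z≤n , refl
∈-betaSet⁻ (suc m) (p ∷ ps) (here refl) = 0 , s≤s z≤n , refl
∈-betaSet⁻ (suc m) []       (there e∈) with j , j<m , refl ← ∈-betaSet⁻ m [] e∈ = suc j , s≤s j<m , refl
∈-betaSet⁻ (suc m) (p ∷ ps) (there e∈) with j , j<m , refl ← ∈-betaSet⁻ m ps e∈ = suc j , s≤s j<m , refl

∈-betaSet⁺ : ∀ n ps {j} → j ℕ.< n → part ps (suc j) ℕ.+ (n ∸ suc j) ∈ betaSet n ps
∈-betaSet⁺ (suc m) []       {zero}  _         = here refl
∈-betaSet⁺ (suc m) (p ∷ ps) {zero}  _         = here refl
∈-betaSet⁺ (suc m) []       {suc j} (s≤s j<m) = there (∈-betaSet⁺ m [] j<m)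
∈-betaSet⁺ (suc m) (p ∷ ps) {suc j} (s≤s j<m) = there (∈-betaSet⁺ m ps j<m)

m-n≡p-q⇒m+q≡p+n : ∀ m n p q → + m - + n ≡ + p - + q → m ℕ.+ q ≡ p ℕ.+ n
m-n≡p-q⇒m+q≡p+n m n p q eq = ℤₚ.+-injective (begin
  + m + + q                 ≡⟨ add-back (+ m) (+ n) (+ q) ⟩
  (+ m - + n) + (+ n + + q) ≡⟨ cong (λ w → w + (+ n + + q)) eq ⟩
  (+ p - + q) + (+ n + + q) ≡⟨ cancel (+ p) (+ n) (+ q) ⟩
  + p + + n                 ∎)
  where
  open ≡-Reasoning
  add-back : ∀ m n q → m + q ≡ (m - n) + (n + q)
  add-back = solve-∀
  cancel : ∀ p n q → (p - q) + (n + q) ≡ p + n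
  cancel = solve-∀

betaSet⇒Bead : ∀ N l {e} → e ∈ betaSet N l → Bead l (+ e - + N)
betaSet⇒Bead N l e∈ with j , j<N , refl ← ∈-betaSet⁻ N l e∈ = j , (begin
  + λⱼ - + suc j                             ≡⟨ add-both (+ λⱼ) (+ suc j) (+ d) ⟩
  (+ λⱼ + + d) - (+ suc j + + d)             ≡⟨ cong₂ _-_ (sym (ℤₚ.pos-+ λⱼ d)) (sym (ℤₚ.pos-+ (suc j) d)) ⟩
  + (λⱼ ℕ.+ d) - + (suc j ℕ.+ d)             ≡⟨ cong (λ n → + (λⱼ ℕ.+ d) - + n) (ℕₚ.m+[n∸m]≡n j<N) ⟩
  + (λⱼ ℕ.+ d) - + N                         ∎)
  where
  open ≡-Reasoning
  λⱼ d : ℕ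
  λⱼ = part l (suc j)
  d = N ∸ suc j
  add-both : ∀ a b d → a - b ≡ (a + d) - (b + d)
  add-both = solve-∀

Bead⇒betaSet : ∀ N l {e} → length l ℕ.≤ N → Bead l (+ e - + N) → e ∈ betaSet N l
Bead⇒betaSet N l {e} |l|≤N (k , bead) with N ℕ.≤? k
... | yes N≤k = contradiction N≤k
  (ℕₚ.<⇒≱ (ℕₚ.<-≤-trans (ℕₚ.n<1+n k)
                         (ℕₚ.≤-trans (ℕₚ.m≤n+m (suc k) e) (ℕₚ.≤-reflexive (sym N≡e+1+k)))))
  where
  N≡e+1+k : N ≡ e ℕ.+ suc k
  N≡e+1+k = ≡-trans (cong (ℕ._+ N) (sym (part-beyond-length l k (ℕₚ.≤-trans |l|≤N N≤k))))
                    (m-n≡p-q⇒m+q≡p+n (part l (suc k)) (suc k) e N bead)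
... | no N≰k = subst (_∈ betaSet N l) (sym e≡λ+d) (∈-betaSet⁺ N l k<N)
  where
  k<N : k ℕ.< N
  k<N = ℕₚ.≰⇒> N≰k
  e≡λ+d : e ≡ part l (suc k) ℕ.+ (N ∸ suc k)
  e≡λ+d = ℕₚ.+-cancelʳ-≡ (suc k) e _ (begin
    e ℕ.+ suc k                               ≡⟨ m-n≡p-q⇒m+q≡p+n (part l (suc k)) (suc k) e N bead ⟨
    part l (suc k) ℕ.+ N                      ≡⟨ cong (part l (suc k) ℕ.+_) (ℕₚ.m+[n∸m]≡n k<N) ⟨
    part l (suc k) ℕ.+ (suc k ℕ.+ (N ∸ suc k)) ≡⟨ reorder (part l (suc k)) (suc k) (N ∸ suc k) ⟩
    part l (suc k) ℕ.+ (N ∸ suc k) ℕ.+ suc k  ∎)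
    where
    open ≡-Reasoning
    reorder : ∀ a b d → a ℕ.+ (b ℕ.+ d) ≡ (a ℕ.+ d) ℕ.+ b
    reorder = ℕ-Solver.solve-∀

betaSet-< : ∀ n {l} → Linked _≥_ l → All (ℕ._< part l 1 ℕ.+ n) (betaSet n l)
betaSet-< zero    _ = []
betaSet-< (suc m) {[]} _ =
  ℕₚ.n<1+n m ∷ All.map (λ e<m → ℕₚ.<-trans e<m (ℕₚ.n<1+n m)) (betaSet-< m {[]} [])
betaSet-< (suc m) {p ∷ ps} dec =
  ℕₚ.+-monoʳ-< p (ℕₚ.n<1+n m) ∷
  All.map (λ e< → ℕₚ.<-≤-trans e< (ℕₚ.+-mono-≤ (second≤first dec) (ℕₚ.n≤1+n m)))
          (betaSet-< m (Linked.tail dec))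

betaSet-unique : ∀ n {l} → Linked _≥_ l → Unique (betaSet n l)
betaSet-unique zero _ = []
betaSet-unique (suc m) {[]} _ =
  All.map (λ e<m e≡m → ℕₚ.<-irrefl (sym e≡m) e<m) (betaSet-< m {[]} []) ∷ betaSet-unique m {[]} []
betaSet-unique (suc m) {p ∷ ps} dec =
  All.map (λ e< e≡ → ℕₚ.<-irrefl (sym e≡) (ℕₚ.<-≤-trans e< (ℕₚ.+-monoˡ-≤ m (second≤first dec))))
          (betaSet-< m (Linked.tail dec))
  ∷ betaSet-unique m (Linked.tail dec)

-- Moving a bead

record BeadMove (l l′ : List ℕ) (p : ℤ) (d : ℕ) : Set where
  field
    bead-before : z l p ≡ false
    gap-before  : z l (p + + d) ≡ true
    gap-after   : z l′ p ≡ true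
    bead-after  : z l′ (p + + d) ≡ false
    elsewhere   : ∀ x → x ≢ p → x ≢ p + + d → z l′ x ≡ z l x

module _ {l l′ p d} (move : BeadMove l l′ p d) (N : ℕ)
         (|l|≤N : length l ℕ.≤ N) (|l′|≤N : length l′ ℕ.≤ N)
         (dec : Linked _≥_ l) (dec′ : Linked _≥_ l′) where
  open BeadMove move

  betaSet-move : ∀ {P rest} → + P - + N ≡ p → betaSet N l ↭ P ∷ rest → betaSet N l′ ↭ (P ℕ.+ d) ∷ rest
  betaSet-move {P} {rest} P-N≡p β↭ =
    unique-⊆-antisym (betaSet-unique N dec′) (P+d∉rest ∷ unique-rest) before⊆after after⊆before
    where
    unique-P∷rest : Unique (P ∷ rest)
    unique-P∷rest = Unique-resp-↭ β↭ (betaSet-unique N dec)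
    unique-rest : Unique rest
    unique-rest with _ ∷ u ← unique-P∷rest = u
    P∉rest : All (P ≢_) rest
    P∉rest with u ∷ _ ← unique-P∷rest = u
    P+d-N≡p+d : + (P ℕ.+ d) - + N ≡ p + + d
    P+d-N≡p+d = ≡-trans (cong (_- + N) (ℤₚ.pos-+ P d))
                        (≡-trans (swap-last (+ P) (+ d) (+ N)) (cong (_+ + d) P-N≡p))
      where
      swap-last : ∀ a b n → (a + b) - n ≡ (a - n) + b
      swap-last = solve-∀
    rest⇒bead : ∀ {e} → e ∈ rest → z l (+ e - + N) ≡ false
    rest⇒bead e∈ = Bead⇒z≡false l _ (betaSet⇒Bead N l (∈-resp-↭ (↭-sym β↭) (there e∈)))
    ≢p+d : ∀ {e} → e ∈ rest → + e - + N ≢ p + + d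
    ≢p+d e∈ eq with () ← ≡-trans (sym gap-before) (≡-trans (cong (z l) (sym eq)) (rest⇒bead e∈))
    ≢p : ∀ {e} → e ∈ rest → + e - + N ≢ p
    ≢p e∈ eq =
      All.lookup P∉rest e∈ (ℕₚ.+-cancelʳ-≡ N P _ (m-n≡p-q⇒m+q≡p+n P N _ N (≡-trans P-N≡p (sym eq))))
    P+d∉rest : All (P ℕ.+ d ≢_) rest
    P+d∉rest = All.tabulate λ e∈ P+d≡e →
      ≢p+d e∈ (≡-trans (cong (λ w → + w - + N) (sym P+d≡e)) P+d-N≡p+d)
    after⊆before : (P ℕ.+ d) ∷ rest ⊆ betaSet N l′
    after⊆before (here refl) = Bead⇒betaSet N l′ |l′|≤N
      (z≡false⇒Bead l′ _ (≡-trans (cong (z l′) P+d-N≡p+d) bead-after))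
    after⊆before (there e∈)  = Bead⇒betaSet N l′ |l′|≤N
      (z≡false⇒Bead l′ _ (≡-trans (elsewhere _ (≢p e∈) (≢p+d e∈)) (rest⇒bead e∈)))
    before⊆after : betaSet N l′ ⊆ (P ℕ.+ d) ∷ rest
    before⊆after {e} e∈ with + e - + N ℤ.≟ p + + d | + e - + N ℤ.≟ p
    ... | yes e-N≡p+d | _ =
      here (ℕₚ.+-cancelʳ-≡ N e _ (m-n≡p-q⇒m+q≡p+n e N _ N (≡-trans e-N≡p+d (sym P+d-N≡p+d))))
    ... | no _ | yes e-N≡p =
      contradiction (subst (Bead l′) e-N≡p (betaSet⇒Bead N l′ e∈)) (z≡true⇒¬Bead l′ p gap-after)
    ... | no e-N≢p+d | no e-N≢p with ∈-resp-↭ β↭ (Bead⇒betaSet N l |l|≤N (z≡false⇒Bead l _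
            (≡-trans (sym (elsewhere _ e-N≢p e-N≢p+d)) (Bead⇒z≡false l′ _ (betaSet⇒Bead N l′ e∈)))))
    ...   | here refl = contradiction P-N≡p e-N≢p
    ...   | there e∈rest = there e∈rest

  contents-move : contents l′ ↭ contents l ++ interval p d
  contents-move = trans (++-cancelʳ-↭ G chain) (++-comm (interval p d) (contents l))
    where
    G : List ℤ
    G = intervals N (betaSet N [])
    -N≤p : - + N ≤ p
    -N≤p = ℤₚ.≤-trans (ℤₚ.neg-mono-≤ (ℤ.+≤+ |l′|≤N)) (z≡true⇒-length≤ l′ p gap-after)
    P : ℕ
    P = ∣ p + + N ∣
    P-N≡p : + P - + N ≡ p
    P-N≡p = ≡-trans (cong (_- + N) (ℤₚ.0≤i⇒+∣i∣≡i 0≤p+N)) (add-sub (+ N) p)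
      where
      0≤p+N : + 0 ≤ p + + N
      0≤p+N = ℤₚ.≤-trans (ℤₚ.≤-reflexive (sym (ℤₚ.+-inverseˡ (+ N)))) (ℤₚ.+-monoˡ-≤ (+ N) -N≤p)
      add-sub : ∀ n p → (p + n) - n ≡ p
      add-sub = solve-∀
    P∈β : P ∈ betaSet N l
    P∈β = Bead⇒betaSet N l |l|≤N (subst (Bead l) (sym P-N≡p) (z≡false⇒Bead l p bead-before))
    rest : List ℕ
    rest = proj₁ (∈⇒↭-∷ P∈β)
    β↭ : betaSet N l ↭ P ∷ rest
    β↭ = proj₂ (∈⇒↭-∷ P∈β)
    split : interval (- + N) (P ℕ.+ d) ≡ interval (- + N) P ++ interval p d
    split = ≡-trans (interval-++ (- + N) P d)
                    (cong (λ a → interval (- + N) P ++ interval a d) (≡-trans (ℤₚ.+-comm (- + N) (+ P)) P-N≡p))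
    chain : contents l′ ++ G ↭ (interval p d ++ contents l) ++ G
    chain = begin
      contents l′ ++ G                                         ↭⟨ contents-++-↭ N l′ |l′|≤N ⟩
      intervals N (betaSet N l′)                               ↭⟨ concatMap-↭ _ (betaSet-move P-N≡p β↭) ⟩
      interval (- + N) (P ℕ.+ d) ++ intervals N rest           ≡⟨ cong (_++ intervals N rest) split ⟩
      (interval (- + N) P ++ interval p d) ++ intervals N rest ≡⟨ Listₚ.++-assoc (interval (- + N) P) _ _ ⟩
      interval (- + N) P ++ interval p d ++ intervals N rest   ↭⟨ shifts (interval (- + N) P) (interval p d) ⟩
      interval p d ++ intervals N (P ∷ rest)     ↭⟨ ++⁺ˡ (interval p d) (concatMap-↭ _ (↭-sym β↭)) ⟩
      interval p d ++ intervals N (betaSet N l)  ↭⟨ ++⁺ˡ (interval p d) (contents-++-↭ N l |l|≤N) ⟨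
      interval p d ++ contents l ++ G                          ≡⟨ Listₚ.++-assoc (interval p d) (contents l) G ⟨
      (interval p d ++ contents l) ++ G                        ∎
      where open PermutationReasoning

BeadMove⇒contents : ∀ {l l′ p d} → Linked _≥_ l → Linked _≥_ l′ → BeadMove l l′ p d →
  contents l′ ↭ contents l ++ interval p d
BeadMove⇒contents {l} {l′} dec dec′ move =
  contents-move move (length l ℕ.+ length l′) (ℕₚ.m≤m+n _ _) (ℕₚ.m≤n+m _ _) dec dec′

-- Adding a box

module _ {l ν r s} (dec : Linked _≥_ l) (decν : Linked _≥_ ν) (box : AddBox l (suc r) s ν) where
  private
    c : ℤ
    c = + s - + suc r

    λᵣ+1≡s : part l (suc r) ℕ.+ 1 ≡ s
    λᵣ+1≡s = proj₁ (proj₂ box)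

    νᵣ≡s : part ν (suc r) ≡ s
    νᵣ≡s = proj₁ (proj₂ (proj₂ box))

    others : ∀ k → k ≢ r → part ν (suc k) ≡ part l (suc k)
    others k k≢r = proj₂ (proj₂ (proj₂ box)) (suc k) (λ eq → k≢r (ℕₚ.suc-injective eq))

    λᵣ<s : part l (suc r) ℕ.< s
    λᵣ<s = ℕₚ.≤-reflexive (≡-trans (ℕₚ.+-comm 1 _) λᵣ+1≡s)

    ν-above : ∀ {k} → k ℕ.< r → s ℕ.≤ part ν (suc k)
    ν-above k<r = subst (ℕ._≤ _) νᵣ≡s (part-antitone decν (ℕₚ.<⇒≤ k<r))

    λ-below : ∀ {k} → r ℕ.< k → part l (suc k) ℕ.< s
    λ-below r<k = ℕₚ.≤-<-trans (part-antitone dec (ℕₚ.<⇒≤ r<k)) λᵣ<s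

    c-1+1≡c : (c - + 1) + + 1 ≡ c
    c-1+1≡c = i-1+1≡i c
      where
      i-1+1≡i : ∀ i → (i - + 1) + + 1 ≡ i
      i-1+1≡i = solve-∀

    c-1≡s-[2+r] : c - + 1 ≡ + s - + suc (suc r)
    c-1≡s-[2+r] = ≡-trans (sub-sub (+ s) (+ suc r)) (cong (λ w → + s - w) (sym (ℤₚ.pos-+ 1 (suc r))))
      where
      sub-sub : ∀ a b → (a - b) - + 1 ≡ a - (+ 1 + b)
      sub-sub = solve-∀

  addBox-old-bead : + part l (suc r) - + suc r ≡ c - + 1
  addBox-old-bead = begin
    + part l (suc r) - + suc r                 ≡⟨ add-sub (+ part l (suc r)) (+ suc r) ⟩
    (+ part l (suc r) + + 1 - + suc r) - + 1
      ≡⟨ cong (λ w → w - + suc r - + 1) (sym (ℤₚ.pos-+ (part l (suc r)) 1)) ⟩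
    (+ (part l (suc r) ℕ.+ 1) - + suc r) - + 1 ≡⟨ cong (λ w → + w - + suc r - + 1) λᵣ+1≡s ⟩
    c - + 1                                    ∎
    where
    open ≡-Reasoning
    add-sub : ∀ a b → a - b ≡ (a + + 1 - b) - + 1
    add-sub = solve-∀

  addBox-new-bead : + part ν (suc r) - + suc r ≡ c
  addBox-new-bead = cong (λ w → + w - + suc r) νᵣ≡s

  addBox-old-gap : ¬ Bead l c
  addBox-old-gap (k , bead) with m-n≡p-q⇒m+q≡p+n (part l (suc k)) (suc k) s (suc r) bead | ℕₚ.<-cmp k r
  ... | eq | tri≈ _ refl _ = ℕₚ.<-irrefl eq (ℕₚ.+-monoˡ-< (suc r) λᵣ<s)
  ... | eq | tri< k<r _ _  = ℕₚ.<-irrefl (sym eq)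
    (ℕₚ.+-mono-≤-< (subst (s ℕ.≤_) (others k (ℕₚ.<⇒≢ k<r)) (ν-above k<r)) (s≤s k<r))
  ... | eq | tri> _ _ r<k  = ℕₚ.<-irrefl eq (ℕₚ.+-mono-< (λ-below r<k) (s≤s r<k))

  addBox-new-gap : ¬ Bead ν (c - + 1)
  addBox-new-gap (k , bead)
    with m-n≡p-q⇒m+q≡p+n (part ν (suc k)) (suc k) s (suc (suc r)) (≡-trans bead c-1≡s-[2+r]) | ℕₚ.<-cmp k r
  ... | eq | tri≈ _ refl _ = ℕₚ.<-irrefl (sym eq)
    (subst (λ w → s ℕ.+ suc r ℕ.< w ℕ.+ suc (suc r)) (sym νᵣ≡s) (ℕₚ.+-monoʳ-< s (ℕₚ.n<1+n (suc r))))
  ... | eq | tri< k<r _ _  = ℕₚ.<-irrefl (sym eq)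
    (ℕₚ.+-mono-≤-< (ν-above k<r) (ℕₚ.<-trans (s≤s k<r) (ℕₚ.n<1+n (suc r))))
  ... | eq | tri> _ _ r<k  = ℕₚ.<-irrefl eq
    (ℕₚ.+-mono-<-≤ (subst (ℕ._< s) (sym (others k (ℕₚ.>⇒≢ r<k))) (λ-below r<k)) (s≤s r<k))

  addBox-elsewhere : ∀ x → x ≢ c - + 1 → x ≢ (c - + 1) + + 1 → z ν x ≡ z l x
  addBox-elsewhere x x≢c-1 x≢c = z-cong ν l x x ν⇒l l⇒ν
    where
    ν⇒l : Bead ν x → Bead l x
    ν⇒l (k , bead) with k ℕ.≟ r
    ... | yes refl = contradiction (≡-trans (sym bead) (≡-trans addBox-new-bead (sym c-1+1≡c))) x≢c
    ... | no  k≢r  = k , ≡-trans (cong (λ w → + w - + suc k) (sym (others k k≢r))) bead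
    l⇒ν : Bead l x → Bead ν x
    l⇒ν (k , bead) with k ℕ.≟ r
    ... | yes refl = contradiction (≡-trans (sym bead) addBox-old-bead) x≢c-1
    ... | no  k≢r  = k , ≡-trans (cong (λ w → + w - + suc k) (others k k≢r)) bead

  addBox⇒BeadMove : BeadMove l ν (c - + 1) 1
  addBox⇒BeadMove = record
    { bead-before = Bead⇒z≡false l _ (r , addBox-old-bead)
    ; gap-before  = subst (λ x → z l x ≡ true) (sym c-1+1≡c) (¬Bead⇒z≡true l c addBox-old-gap)
    ; gap-after   = ¬Bead⇒z≡true ν (c - + 1) addBox-new-gap
    ; bead-after  = subst (λ x → z ν x ≡ false) (sym c-1+1≡c) (Bead⇒z≡false ν c (r , addBox-new-bead))
    ; elsewhere   = addBox-elsewhere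
    }

-- Residue classes, hook removal and quotients

residue : ℕ → List ℕ → ℕ → ℤ → Bool
residue t l i k = z l (+ t * k + + i)

t*k+i<t*[k+1] : ∀ t k {i} → i ℕ.< t → + t * k + + i < + t * (k + + 1)
t*k+i<t*[k+1] t k i<t =
  ℤₚ.<-≤-trans (ℤₚ.+-monoʳ-< (+ t * k) (ℤ.+<+ i<t)) (ℤₚ.≤-reflexive (distrib (+ t) k))
  where
  distrib : ∀ t k → t * k + t ≡ t * (k + + 1)
  distrib = solve-∀

<⇒t*k+i<t*l+j : ∀ t {k l i j} → k < l → i ℕ.< t → + t * k + + i < + t * l + + j
<⇒t*k+i<t*l+j t {k} {l} {j = j} k<l i<t = ℤₚ.<-≤-trans (t*k+i<t*[k+1] t k i<t)
  (ℤₚ.≤-trans (ℤₚ.*-monoˡ-≤-nonNeg (+ t) k+1≤l) (ℤₚ.i≤i+j (+ t * l) (+ j)))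
  where
  k+1≤l : k + + 1 ≤ l
  k+1≤l = ≤∧≢⇒+1≤ (ℤₚ.<⇒≤ k<l) (ℤₚ.<⇒≢ k<l)

division-unique : ∀ t {i j k l} → i ℕ.< t → j ℕ.< t → + t * k + + i ≡ + t * l + + j → k ≡ l × i ≡ j
division-unique t {k = k} {l} i<t j<t eq with ℤₚ.<-cmp k l
... | tri≈ _ refl _ = refl , ℤₚ.+-injective (+-cancelˡ-≡ (+ t * k) eq)
... | tri< k<l _ _  = contradiction eq (ℤₚ.<⇒≢ (<⇒t*k+i<t*l+j t k<l i<t))
... | tri> _ _ l<k  = contradiction (sym eq) (ℤₚ.<⇒≢ (<⇒t*k+i<t*l+j t l<k j<t))

/ℕ-%ℕ-decomposition : ∀ t .{{_ : ℕ.NonZero t}} x → x ≡ + t * (x /ℕ t) + + (x %ℕ t)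
/ℕ-%ℕ-decomposition t x =
  ≡-trans (ℤDivMod.a≡a%ℕn+[a/ℕn]*n x t) (reorder (+ (x %ℕ t)) (x /ℕ t) (+ t))
  where
  reorder : ∀ r q t → r + q * t ≡ t * q + r
  reorder = solve-∀

-- Removing a t-hook swaps two adjacent entries of one residue class and fixes the other classes.
removeHook-charge : ∀ {t l₀ l₁ i e} .{{_ : ℕ.NonZero t}} → i ℕ.< t → RemoveHook t l₀ l₁ →
  HasCharge (residue t l₀ i) e ⇔ HasCharge (residue t l₁ i) e
removeHook-charge {t} {l₀} {l₁} {i} {e} i<t (_ , j , z₀j≡1 , z₀j+t≡0 , z₁j≡0 , z₁j+t≡1 , elsewhere) =
  by-class i<t (i ℕ.≟ i′)
  where
  q : ℤ
  q = j /ℕ t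
  i′ : ℕ
  i′ = j %ℕ t
  i′<t : i′ ℕ.< t
  i′<t = ℤDivMod.n%ℕd<d j t
  j≡tq+i′ : j ≡ + t * q + + i′
  j≡tq+i′ = /ℕ-%ℕ-decomposition t j
  j+t≡t[q+1]+i′ : j + + t ≡ + t * (q + + 1) + + i′
  j+t≡t[q+1]+i′ = ≡-trans (cong (_+ + t) j≡tq+i′) (distrib (+ t) q (+ i′))
    where
    distrib : ∀ t q i → t * q + i + t ≡ t * (q + + 1) + i
    distrib = solve-∀
  by-class : ∀ {i} → i ℕ.< t → Dec (i ≡ i′) →
             HasCharge (residue t l₀ i) e ⇔ HasCharge (residue t l₁ i) e
  by-class {i} i<t (no i≢i′) = mk⇔ (charge-cong same) (charge-cong (λ k → sym (same k)))
    where
    same : ∀ k → residue t l₀ i k ≡ residue t l₁ i k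
    same k = sym (elsewhere (+ t * k + + i)
      (λ eq → i≢i′ (proj₂ (division-unique t i<t i′<t (≡-trans eq j≡tq+i′))))
      (λ eq → i≢i′ (proj₂ (division-unique t i<t i′<t (≡-trans eq j+t≡t[q+1]+i′)))))
  by-class _ (yes refl) =
    mk⇔ (charge-swap q same bits) (charge-swap q (λ k k≢q k≢q+1 → sym (same k k≢q k≢q+1)) (sym bits))
    where
    same : ∀ k → k ≢ q → k ≢ q + + 1 → residue t l₀ i′ k ≡ residue t l₁ i′ k
    same k k≢q k≢q+1 = sym (elsewhere (+ t * k + + i′)
      (λ eq → k≢q (proj₁ (division-unique t i′<t i′<t (≡-trans eq j≡tq+i′))))
      (λ eq → k≢q+1 (proj₁ (division-unique t i′<t i′<t (≡-trans eq j+t≡t[q+1]+i′)))))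
    bits : bit (residue t l₀ i′ q) ℕ.+ bit (residue t l₀ i′ (q + + 1))
         ≡ bit (residue t l₁ i′ q) ℕ.+ bit (residue t l₁ i′ (q + + 1))
    bits rewrite sym j≡tq+i′ | sym j+t≡t[q+1]+i′ | z₀j≡1 | z₀j+t≡0 | z₁j≡0 | z₁j+t≡1 = refl

removeHooks-charge : ∀ {t l₀ l₁ i e} .{{_ : ℕ.NonZero t}} → i ℕ.< t → Star (RemoveHook t) l₀ l₁ →
  HasCharge (residue t l₀ i) e ⇔ HasCharge (residue t l₁ i) e
removeHooks-charge i<t ε            = ⇔.refl
removeHooks-charge i<t (hook ◅ rest) = ⇔.trans (removeHook-charge i<t hook) (removeHooks-charge i<t rest)

quotient-charge : ∀ {t i l ν} sh → Linked _≥_ ν → (∀ j → z ν j ≡ z l (+ t * (j + sh) + + i)) →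
  HasCharge (residue t l i) sh
quotient-charge {t} {i} {l} sh dec quotient =
  subst (HasCharge (residue t l i)) (0-[-sh]≡sh sh)
    (charge-shift (- sh) (λ x → sym (≡-trans (quotient (x + - sh)) (cong (z l) (unshift (+ t) x sh (+ i)))))
                  (partition-charge dec))
  where
  0-[-sh]≡sh : ∀ sh → + 0 - - sh ≡ sh
  0-[-sh]≡sh = solve-∀
  unshift : ∀ t x sh i → t * ((x + - sh) + sh) + i ≡ t * x + i
  unshift = solve-∀

-- The residue class i of a t-core is the step sequence at the level m of b_i = i + t m.
core-charge : ∀ {t μ i b m} → i ℕ.< t → NoHook t μ → IsB t i μ b → b ≡ + i + + t * m →
  HasCharge (residue t μ i) m
core-charge {t} {μ} {i} {m = m} i<t no-hook (_ , zb≡1 , minimal) b≡i+tm = charge-cong agree (step-charge m)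
  where
  ones-from-m : ∀ d → residue t μ i (m + + d) ≡ true
  ones-from-m zero = ≡-trans (cong (z μ) (≡-trans (tm+i≡i+tm (+ t) m (+ i)) (sym b≡i+tm))) zb≡1
    where
    tm+i≡i+tm : ∀ t m i → t * (m + + 0) + i ≡ i + t * m
    tm+i≡i+tm = solve-∀
  ones-from-m (suc d) with residue t μ i (m + + suc d) in next≡
  ... | true  = refl
  ... | false = contradiction (ones-from-m d , ≡-trans (cong (z μ) next-position) next≡)
                              (no-hook (+ t * (m + + d) + + i))
    where
    next-position : + t * (m + + d) + + i + + t ≡ + t * (m + + suc d) + + i
    next-position = ≡-trans (distrib (+ t) m (+ d) (+ i)) (cong (λ w → + t * (m + w) + + i) (sym (ℤₚ.pos-+ 1 d)))
      where
      distrib : ∀ t m d i → t * (m + d) + i + t ≡ t * (m + (+ 1 + d)) + i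
      distrib = solve-∀
  zeros-before-m : ∀ k → k < m → residue t μ i k ≡ false
  zeros-before-m k k<m with residue t μ i k in here≡
  ... | false = refl
  ... | true  = contradiction (minimal _ (k , ℤₚ.+-comm (+ t * k) (+ i)) here≡)
                  (ℤₚ.<⇒≱ (subst (_ <_) (≡-trans (ℤₚ.+-comm (+ t * m) (+ i)) (sym b≡i+tm))
                                        (<⇒t*k+i<t*l+j t k<m i<t)))
  agree : ∀ k → step m k ≡ residue t μ i k
  agree k with m ℤ.≤? k
  ... | yes m≤k with d , refl ← ≤⇒≡+ m≤k = sym (ones-from-m d)
  ... | no  m≰k = sym (zeros-before-m k (ℤₚ.≰⇒> m≰k))

shift-charge : ∀ {t i l μ ν} .{{_ : ℕ.NonZero t}} → i ℕ.< t → Linked _≥_ ν →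
  Star (RemoveHook t) l μ → (quotient : QuotientOf t i l ν) → HasCharge (residue t μ i) (proj₁ quotient)
shift-charge {t} {i} {l} i<t dec core (sh , quotient) =
  Equivalence.to (removeHooks-charge i<t core) (quotient-charge {t} {i} {l} sh dec quotient)

BeadMove-lift : ∀ {t l l′} .{{_ : ℕ.NonZero t}} (q q′ : Fin t → List ℕ) (sh : Fin t → ℤ) →
  (∀ j y → z (q j) y ≡ z l (+ t * (y + sh j) + + toℕ j)) →
  (∀ j y → z (q′ j) y ≡ z l′ (+ t * (y + sh j) + + toℕ j)) →
  ∀ i {y} → (∀ j → j ≢ i → q′ j ≡ q j) → BeadMove (q i) (q′ i) y 1 →
  BeadMove l l′ (+ t * (y + sh i) + + toℕ i) t
BeadMove-lift {t} {l} {l′} q q′ sh quotient quotient′ i {y} others move = record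
  { bead-before = ≡-trans (sym (quotient i y)) bead-before
  ; gap-before  = ≡-trans (cong (z l) P+t≡) (≡-trans (sym (quotient i (y + + 1))) gap-before)
  ; gap-after   = ≡-trans (sym (quotient′ i y)) gap-after
  ; bead-after  = ≡-trans (cong (z l′) P+t≡) (≡-trans (sym (quotient′ i (y + + 1))) bead-after)
  ; elsewhere   = elsewhere′
  }
  where
  open BeadMove move
  P : ℤ
  P = + t * (y + sh i) + + toℕ i
  P+t≡ : P + + t ≡ + t * ((y + + 1) + sh i) + + toℕ i
  P+t≡ = distrib (+ t) y (sh i) (+ toℕ i)
    where
    distrib : ∀ t y s i → t * (y + s) + i + t ≡ t * ((y + + 1) + s) + i
    distrib = solve-∀
  elsewhere′ : ∀ x → x ≢ P → x ≢ P + + t → z l′ x ≡ z l x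
  elsewhere′ x x≢P x≢P+t = begin
    z l′ x               ≡⟨ cong (z l′) x≡ ⟨
    z l′ (position j k)  ≡⟨ quotient′ j (k - sh j) ⟨
    z (q′ j) (k - sh j)  ≡⟨ same-class (j Finₚ.≟ i) ⟩
    z (q j) (k - sh j)   ≡⟨ quotient j (k - sh j) ⟩
    z l (position j k)   ≡⟨ cong (z l) x≡ ⟩
    z l x                ∎
    where
    open ≡-Reasoning
    k : ℤ
    k = x /ℕ t
    j : Fin t
    j = fromℕ< (ℤDivMod.n%ℕd<d x t)
    position : Fin t → ℤ → ℤ
    position j k = + t * ((k - sh j) + sh j) + + toℕ j
    x≡ : position j k ≡ x
    x≡ = ≡-trans (cong₂ (λ u v → + t * u + + v) (sub-add k (sh j)) (Finₚ.toℕ-fromℕ< _))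
                 (sym (/ℕ-%ℕ-decomposition t x))
      where
      sub-add : ∀ k s → (k - s) + s ≡ k
      sub-add = solve-∀
    same-class : Dec (j ≡ i) → z (q′ j) (k - sh j) ≡ z (q j) (k - sh j)
    same-class (no j≢i)  = cong (λ l → z l (k - sh j)) (others j j≢i)
    same-class (yes refl) = elsewhere (k - sh j)
      (λ eq → x≢P (≡-trans (sym x≡) (cong (λ w → + t * (w + sh j) + + toℕ j) eq)))
      (λ eq → x≢P+t (≡-trans (sym x≡) (≡-trans (cong (λ w → + t * (w + sh j) + + toℕ j) eq) (sym P+t≡))))

[]≔-preserves : ∀ {A : Set} {n} (P : A → Set) (xs : Vec A n) i {x} →
  (∀ j → P (lookup xs j)) → P x → ∀ j → P (lookup (xs [ i ]≔ x) j)
[]≔-preserves P xs i {x} Pxs Px j with j Finₚ.≟ i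
... | yes refl = subst P (sym (Vecₚ.lookup∘update j xs x)) Px
... | no  j≢i  = subst P (sym (Vecₚ.lookup∘update′ j≢i xs x)) (Pxs j)

quotient-shift : ∀ {t lam μ} qs → Littlewood t lam μ qs → Fin t → ℤ
quotient-shift qs L j = proj₁ (proj₂ L j)

shift-core-charge : ∀ {t lam μ} .{{_ : ℕ.NonZero t}} qs (L : Littlewood t lam μ qs) →
  (∀ j → Linked _≥_ (lookup qs j)) → ∀ j → HasCharge (residue t μ (toℕ j)) (quotient-shift qs L j)
shift-core-charge qs L dec j = shift-charge (Finₚ.toℕ<n j) (dec j) (proj₁ (proj₁ L)) (proj₂ L j)

shifts-agree : ∀ {t lam lam′ μ} .{{_ : ℕ.NonZero t}} qs qs′
  (L : Littlewood t lam μ qs) (L′ : Littlewood t lam′ μ qs′) →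
  (∀ j → Linked _≥_ (lookup qs j)) → (∀ j → Linked _≥_ (lookup qs′ j)) →
  ∀ j → quotient-shift qs′ L′ j ≡ quotient-shift qs L j
shifts-agree qs qs′ L L′ dec dec′ j =
  charge-unique (shift-core-charge qs′ L′ dec′ j) (shift-core-charge qs L dec j)

shift≡level : ∀ {t lam μ b m} .{{_ : ℕ.NonZero t}} qs (L : Littlewood t lam μ qs) →
  (∀ j → Linked _≥_ (lookup qs j)) → ∀ i → IsB t (toℕ i) μ b → b ≡ + toℕ i + + t * m →
  quotient-shift qs L i ≡ m
shift≡level qs L dec i isB b≡i+tm =
  charge-unique (shift-core-charge qs L dec i) (core-charge (Finₚ.toℕ<n i) (proj₂ (proj₁ L)) isB b≡i+tm)

addBox⇒Littlewood-BeadMove : ∀ {t lam lam⁺ μ ν r s} .{{_ : ℕ.NonZero t}} (qs : Vec (List ℕ) t) i →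
  (L : Littlewood t lam μ qs) → Littlewood t lam⁺ μ (qs [ i ]≔ ν) →
  (∀ j → Linked _≥_ (lookup qs j)) → Linked _≥_ ν → AddBox (lookup qs i) (suc r) s ν →
  BeadMove lam lam⁺ (+ t * (((+ s - + suc r) - + 1) + quotient-shift qs L i) + + toℕ i) t
addBox⇒Littlewood-BeadMove {t} {lam⁺ = lam⁺} {ν = ν} {r = r} {s = s} qs i L L⁺ dec decν box =
  BeadMove-lift (lookup qs) (lookup qs⁺) (quotient-shift qs L) (λ j → proj₂ (proj₂ L j)) quotient⁺ i
                (λ j j≢i → Vecₚ.lookup∘update′ j≢i qs ν) move
  where
  qs⁺ : Vec (List ℕ) t
  qs⁺ = qs [ i ]≔ ν
  quotient⁺ : ∀ j y → z (lookup qs⁺ j) y ≡ z lam⁺ (+ t * (y + quotient-shift qs L j) + + toℕ j)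
  quotient⁺ j y = ≡-trans (proj₂ (proj₂ L⁺ j) y)
    (cong (λ w → z lam⁺ (+ t * (y + w) + + toℕ j))
          (shifts-agree qs qs⁺ L L⁺ dec ([]≔-preserves (Linked _≥_) qs i dec decν) j))
  move : BeadMove (lookup qs i) (lookup qs⁺ i) ((+ s - + suc r) - + 1) 1
  move = subst (λ ν′ → BeadMove (lookup qs i) ν′ ((+ s - + suc r) - + 1) 1) (sym (Vecₚ.lookup∘update i qs ν))
               (addBox⇒BeadMove (dec i) decν box)

-- μ enters only through the Littlewood decompositions (the core's NoHook component).
lemma5p2 : (t : ℕ) (μ : List ℕ) → IsPartition μ → IsTCore t μ →
    (qs : Vec (List ℕ) t) → (∀ j → IsPartition (lookup qs j)) →
    (i : Fin t) (ν : List ℕ) (r s : ℕ) → IsPartition ν → AddBox (lookup qs i) r s ν →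
    (lam lam⁺ : List ℕ) → IsPartition lam → IsPartition lam⁺ →
    Littlewood t lam μ qs → Littlewood t lam⁺ μ (qs [ i ]≔ ν) →
    (b : ℤ) → IsB t (toℕ i) μ b →
    (contents lam⁺ ∖ contents lam) ↭ map (λ k → (+ s - + r) * + t + b - + k) (upTo t)
lemma5p2 zero _ _ _ _ _ () _ _ _ _ _ _ _ _ _ _ _ _ _
lemma5p2 (suc _) _ _ _ _ _ _ _ zero _ _ (() , _) _ _ _ _ _ _ _ _
lemma5p2 t@(suc _) _ _ _ qs qs-partitions i ν (suc r) s (ν-dec , _) box
         lam lam⁺ (dec , _) (dec⁺ , _) L L⁺ b isB@((m , b≡i+tm) , _) =
  begin
  contents lam⁺ ∖ contents lam                  ↭⟨ ∖-respˡ-↭ (contents lam) (BeadMove⇒contents dec dec⁺ move) ⟩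
  (contents lam ++ interval P t) ∖ contents lam ≡⟨ xs++ys∖xs≡ys (contents lam) (interval P t) ⟩
  interval P t                                  ↭⟨ interval-↭-descending P t ⟩
  map (λ k → (P + + t) - + k) (upTo t)          ≡⟨ Listₚ.map-cong (λ k → cong (_- + k) P+t≡ct+b) (upTo t) ⟩
  map (λ k → (+ s - + suc r) * + t + b - + k) (upTo t) ∎
  where
  open PermutationReasoning
  qs-dec : ∀ j → Linked _≥_ (lookup qs j)
  qs-dec j = proj₁ (qs-partitions j)
  c P : ℤ
  c = + s - + suc r
  P = + t * ((c - + 1) + quotient-shift qs L i) + + toℕ i
  move : BeadMove lam lam⁺ P t
  move = addBox⇒Littlewood-BeadMove qs i L L⁺ qs-dec ν-dec box
  P+t≡ct+b : P + + t ≡ c * + t + b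
  P+t≡ct+b = ≡-trans (cong (λ w → + t * ((c - + 1) + w) + + toℕ i + + t) (shift≡level qs L qs-dec i isB b≡i+tm))
             (≡-trans (collect (+ t) c m (+ toℕ i)) (cong (λ w → c * + t + w) (sym b≡i+tm)))
    where
    collect : ∀ t c m i → t * ((c - + 1) + m) + i + t ≡ c * t + (i + t * m)
    collect = solve-∀
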